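{- For every ordinal $\alpha$ with $2\le\alpha<\varepsilon_0$, $$\mathscr F^\ast_\alpha=\bigcup_{0<c<\omega}\mathbf F^c_\alpha.$$
   Context: Ordinals are below $\varepsilon_0$ in Cantor normal form; limit ordinals have fundamental sequences $(\gamma+\omega^{\beta+1})(x)=\gamma+\omega^\beta\cdot(x+1)$, $(\gamma+\omega^{\lambda'})(x)=\gamma+\omega^{\lambda'(x)}$ for $\lambda'$ limit. Fast-growing functions: $F_0(x)=x+1$, $F_{\alpha+1}(x)=F_\alpha^{x+1}(x)$, $F_\lambda(x)=F_{\lambda(x)}(x)$; $F^c_\alpha$ is the $c$-fold iterate. Extended Grzegorczyk class $\mathscr F_\alpha$: smallest class of functions $\mathbb N^k\to\mathbb N$ containing the zero function, addition, projections and $F_\alpha$, closed under composition and limited primitive recursion (primitive recursion bounded by some function of the class applied to the max of the arguments). $\mathscr F_{<\alpha}=\bigcup_{\beta<\alpha}\mathscr F_\beta$. $\mathrm{DTime}(t(n))$: languages decided by a deterministic Turing machine in at most $t(n)$ steps on inputs of length $n$. $\mathscr F^\ast_\alpha=\bigcup_{c<\omega}\mathrm{DTime}(F_\alpha^c(n))$, and for finite $c>0$, $\mathbf F^c_\alpha=\bigcup_{p\in\mathscr F_{<\alpha}}\mathrm{DTime}(F^c_\alpha(p(n)))$ ($p$ unary). -}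

module Defs where

open import Data.Nat using (ℕ; zero; suc; _+_; _≤_; _<_; _⊔_)
open import Data.Fin using (Fin)
open import Data.Vec using (Vec; []; _∷_; lookup; tabulate; foldr′)
open import Data.List using (List; []; _∷_; length; map)
open import Data.Bool using (Bool)
open import Data.Maybe using (Maybe; just; nothing)
open import Data.Product using (Σ; _×_; _,_; ∃; ∃-syntax)
open import Data.Sum using (_⊎_)
open import Relation.Binary.PropositionalEquality using (_≡_)

-- Ordinals below ε₀ as Cantor-normal-form terms
--   𝟎            = 0
--   ω^ a + b     = ω^a + b

data Ord : Set where
  𝟎    : Ord
  ω^_+_ : Ord → Ord → Ord

infixr 5 ω^_+_

-- lexicographic order (correct on CNF terms)
data _<ₒ_ : Ord → Ord → Set where
  z<ω  : ∀ {a b} → 𝟎 <ₒ (ω^ a + b)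
  exp< : ∀ {a b c d} → a <ₒ c → (ω^ a + b) <ₒ (ω^ c + d)
  tl<  : ∀ {a b d} → b <ₒ d → (ω^ a + b) <ₒ (ω^ a + d)

_≤ₒ_ : Ord → Ord → Set
a ≤ₒ b = a <ₒ b ⊎ a ≡ b

data CNF : Ord → Set where
  cnf𝟎 : CNF 𝟎
  cnf1 : ∀ {a} → CNF a → CNF (ω^ a + 𝟎)
  cnf2 : ∀ {a c d} → CNF a → CNF (ω^ c + d) → c ≤ₒ a → CNF (ω^ a + (ω^ c + d))

two : Ord
two = ω^ 𝟎 + (ω^ 𝟎 + 𝟎)

ω^_·_ : Ord → ℕ → Ord
ω^ a · zero  = 𝟎
ω^ a · suc k = ω^ a + (ω^ a · k)

-- Suc α β : α = β + 1
data Suc : Ord → Ord → Set where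
  s-one  : Suc (ω^ 𝟎 + 𝟎) 𝟎
  s-tail : ∀ {a b b'} → Suc b b' → Suc (ω^ a + b) (ω^ a + b')

-- FS λ x μ : λ is a limit and λ(x) = μ (the fundamental sequences)
data FS : Ord → ℕ → Ord → Set where
  fs-tail : ∀ {a b x b'} → FS b x b' → FS (ω^ a + b) x (ω^ a + b')
  fs-succ : ∀ {a a' x} → Suc a a' → FS (ω^ a + 𝟎) x (ω^ a' · suc x)
  fs-lim  : ∀ {a x a''} → FS a x a'' → FS (ω^ a + 𝟎) x (ω^ a'' + 𝟎)

data Iter (R : ℕ → ℕ → Set) : ℕ → ℕ → ℕ → Set where
  it0 : ∀ {x} → Iter R 0 x x
  itS : ∀ {n x y z} → R x y → Iter R n y z → Iter R (suc n) x z

-- FG α x y : F_α(x) = y   (graph of the fast-growing hierarchy)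
data FG : Ord → ℕ → ℕ → Set where
  fg0 : ∀ {x} → FG 𝟎 x (suc x)
  fgs : ∀ {α β x y} → Suc α β → Iter (FG β) (suc x) x y → FG α x y
  fgl : ∀ {α β x y} → FS α x β → FG β x y → FG α x y

-- Extended Grzegorczyk classes 𝓕_α (functions ℕ^k → ℕ as Vec ℕ k → ℕ)

maxV : ∀ {n} → Vec ℕ n → ℕ
maxV = foldr′ _⊔_ 0

data Grz (α : Ord) : (k : ℕ) → (Vec ℕ k → ℕ) → Set where
  zeroG : ∀ {k} (f : Vec ℕ k → ℕ) → (∀ v → f v ≡ 0) → Grz α k f
  addG  : (f : Vec ℕ 2 → ℕ) → (∀ x y → f (x ∷ y ∷ []) ≡ x + y) → Grz α 2 f
  projG : ∀ {k} (f : Vec ℕ k → ℕ) (i : Fin k) → (∀ v → f v ≡ lookup v i) → Grz α k f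
  FG-G  : (f : Vec ℕ 1 → ℕ) → (∀ x → FG α x (f (x ∷ []))) → Grz α 1 f
  compG : ∀ {k m} (f : Vec ℕ k → ℕ) (h : Vec ℕ m → ℕ) (gs : Fin m → Vec ℕ k → ℕ) →
          Grz α m h → (∀ i → Grz α k (gs i)) →
          (∀ v → f v ≡ h (tabulate (λ i → gs i v))) → Grz α k f
  lprG  : ∀ {k} (f : Vec ℕ (suc k) → ℕ) (g : Vec ℕ k → ℕ)
            (h : Vec ℕ (suc (suc k)) → ℕ) (b : Vec ℕ 1 → ℕ) →
          Grz α k g → Grz α (suc (suc k)) h → Grz α 1 b →
          (∀ v → f (0 ∷ v) ≡ g v) →
          (∀ y v → f (suc y ∷ v) ≡ h (y ∷ f (y ∷ v) ∷ v)) →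
          (∀ w → f w ≤ b (maxV w ∷ [])) →
          Grz α (suc k) f

GrzBelow : Ord → (ℕ → ℕ) → Set
GrzBelow α p = Σ Ord λ β → CNF β × β <ₒ α × Grz β 1 (λ v → p (lookup v Fin.zero))
  where import Data.Fin as Fin

-- Deterministic single-tape Turing machines over input alphabet Bool,
-- tape alphabet Maybe Bool (nothing = blank).

Sym : Set
Sym = Maybe Bool

data Dir : Set where
  L R : Dir

record TM : Set where
  field
    Q     : ℕ
    start : Fin Q
    δ     : Fin Q → Sym → Maybe (Fin Q × Sym × Dir)   -- nothing = halt
    acc   : Fin Q → Bool

record Config (M : TM) : Set where
  constructor cfg
  field
    state : Fin (TM.Q M)
    left  : List Sym    -- reversed, nearest cell first
    head  : Sym
    right : List Sym

initCfg : (M : TM) → List Bool → Config M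
initCfg M []      = cfg (TM.start M) [] nothing []
initCfg M (b ∷ w) = cfg (TM.start M) [] (just b) (map just w)

move : ∀ {M} → Fin (TM.Q M) → Sym → Dir → List Sym → List Sym → Config M
move q s L []       r        = cfg q [] s r                -- stay at left end
move q s L (x ∷ l)  r        = cfg q l x (s ∷ r)
move q s R l        []       = cfg q (s ∷ l) nothing []
move q s R l        (x ∷ r)  = cfg q (s ∷ l) x r

step : ∀ {M} → Config M → Config M
step {M} (cfg q l h r) with TM.δ M q h
... | nothing            = cfg q l h r
... | just (q' , s , d)  = move q' s d l r

halted : ∀ {M} → Config M → Set
halted {M} (cfg q l h r) = TM.δ M q h ≡ nothing

run : ∀ {M} → ℕ → Config M → Config M
run zero    c = c
run (suc n) c = run n (step c)

Language : Set
Language = List Bool → Bool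

DecidesWithin : TM → Language → List Bool → ℕ → Set
DecidesWithin M Lg w t =
  Σ ℕ λ k → k ≤ t × halted (run k (initCfg M w))
          × TM.acc M (Config.state (run k (initCfg M w))) ≡ Lg w

-- L ∈ DTime(t(n)) where t is given by its graph B n y  (y = t(n))
DTime : (ℕ → ℕ → Set) → Language → Set
DTime B Lg = Σ TM λ M → ∀ w → Σ ℕ λ y → B (length w) y × DecidesWithin M Lg w y

-- 𝓕*_α = ⋃_{c<ω} DTime(F_α^c(n))
FStar : Ord → Language → Set
FStar α Lg = Σ ℕ λ c → DTime (λ n y → Iter (FG α) c n y) Lg

-- 𝐅^c_α = ⋃_{p ∈ 𝓕_{<α}} DTime(F_α^c(p(n)))
Fbold : ℕ → Ord → Language → Set
Fbold c α Lg = Σ (ℕ → ℕ) λ p → GrzBelow α p × DTime (λ n y → Iter (FG α) c (p n) y) Lg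

-- The inclusion 𝓕*_α ⊆ ⋃ 𝐅^c_α takes p = id and uses F_α^c ≤ F_α^(c+1).
-- Conversely, every p ∈ 𝓕_β with β < α is bounded by some iterate F_α^e: for β < α there is an
-- N with β ≼⟨ N ⟩ α (β is reached from α by predecessor steps and fundamental-sequence steps at N),
-- whence F_β(x) ≤ F_β(x + N) ≤ F_α(x + N) ≤ F_α^(N+1)(x), and such bounds are preserved by the
-- closure operations of 𝓕_β (addition is below F_α as α ≥ 1). So F_α^c(p(n)) ≤ F_α^(e+c)(n).
-- Monotonicity of F_α in its argument, used throughout, rests on the Bachmann property
-- λ(x) ≼⟨ x + 1 ⟩ λ(x + 1) of the fundamental sequences.

module Submission where

open import Defs
open import Data.Nat using (ℕ; zero; suc; _+_; _≤_; _<_; _⊔_; _≤′_; ≤′-refl; ≤′-step; z≤n; s≤s)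
open import Data.Nat.Properties
open import Data.Fin using (Fin)
import Data.Fin as Fin
open import Data.Vec using (Vec; []; _∷_; lookup; tabulate)
open import Data.Vec.Properties using (lookup∘tabulate)
open import Data.List using (length)
open import Data.Product using (Σ; _×_; _,_; proj₁; proj₂; ∃; ∃-syntax)
open import Data.Sum using (inj₁; inj₂)
open import Data.Empty using (⊥; ⊥-elim)
open import Data.Unit using (⊤; tt)
open import Induction.WellFounded using (Acc; acc)
open import Relation.Binary.PropositionalEquality

-- Cantor normal forms

<ₒ-trans : ∀ {a b c} → a <ₒ b → b <ₒ c → a <ₒ c
<ₒ-trans z<ω      (exp< _) = z<ω
<ₒ-trans z<ω      (tl< _)  = z<ω
<ₒ-trans (exp< p) (exp< q) = exp< (<ₒ-trans p q)
<ₒ-trans (exp< p) (tl< _)  = exp< p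
<ₒ-trans (tl< _)  (exp< q) = exp< q
<ₒ-trans (tl< p)  (tl< q)  = tl< (<ₒ-trans p q)

<-≤ₒ-trans : ∀ {a b c} → a <ₒ b → b ≤ₒ c → a <ₒ c
<-≤ₒ-trans p (inj₁ q)    = <ₒ-trans p q
<-≤ₒ-trans p (inj₂ refl) = p

HeadExp≤ : Ord → Ord → Set
HeadExp≤ 𝟎          a = ⊤
HeadExp≤ (ω^ c + d) a = c ≤ₒ a

HeadExp≤-< : ∀ {a d e} → HeadExp≤ d a → e <ₒ d → HeadExp≤ e a
HeadExp≤-< h z<ω      = tt
HeadExp≤-< h (exp< p) = inj₁ (<-≤ₒ-trans p h)
HeadExp≤-< h (tl< _)  = h

CNF-exp : ∀ {a b} → CNF (ω^ a + b) → CNF a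
CNF-exp (cnf1 ca)     = ca
CNF-exp (cnf2 ca _ _) = ca

CNF-tail : ∀ {a b} → CNF (ω^ a + b) → CNF b
CNF-tail (cnf1 _)      = cnf𝟎
CNF-tail (cnf2 _ cb _) = cb

CNF-head : ∀ {a b} → CNF (ω^ a + b) → HeadExp≤ b a
CNF-head (cnf1 _)     = tt
CNF-head (cnf2 _ _ h) = h

CNF-cons : ∀ {a b} → CNF a → CNF b → HeadExp≤ b a → CNF (ω^ a + b)
CNF-cons ca cnf𝟎           h = cnf1 ca
CNF-cons ca cb@(cnf1 _)     h = cnf2 ca cb h
CNF-cons ca cb@(cnf2 _ _ _) h = cnf2 ca cb h

CNF-ω^· : ∀ {a} → CNF a → ∀ k → CNF (ω^ a · k)
CNF-ω^· ca zero          = cnf𝟎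
CNF-ω^· ca (suc zero)    = cnf1 ca
CNF-ω^· ca (suc (suc k)) = cnf2 ca (CNF-ω^· ca (suc k)) (inj₂ refl)

Suc⇒<ₒ : ∀ {a b} → Suc a b → b <ₒ a
Suc⇒<ₒ s-one      = z<ω
Suc⇒<ₒ (s-tail s) = tl< (Suc⇒<ₒ s)

FS⇒<ₒ : ∀ {a x b} → FS a x b → b <ₒ a
FS⇒<ₒ (fs-tail f) = tl< (FS⇒<ₒ f)
FS⇒<ₒ (fs-succ s) = exp< (Suc⇒<ₒ s)
FS⇒<ₒ (fs-lim f)  = exp< (FS⇒<ₒ f)

FS-pos : ∀ {α x μ} → FS α x μ → 𝟎 <ₒ μ
FS-pos (fs-tail _) = z<ω
FS-pos (fs-succ _) = z<ω
FS-pos (fs-lim _)  = z<ω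

Suc-HeadExp≤ : ∀ {a b b'} → Suc b b' → HeadExp≤ b a → HeadExp≤ b' a
Suc-HeadExp≤ s-one      h = tt
Suc-HeadExp≤ (s-tail s) h = h

FS-HeadExp≤ : ∀ {a b x b'} → FS b x b' → HeadExp≤ b a → HeadExp≤ b' a
FS-HeadExp≤ (fs-tail f) h = h
FS-HeadExp≤ (fs-succ s) h = inj₁ (<-≤ₒ-trans (Suc⇒<ₒ s) h)
FS-HeadExp≤ (fs-lim f)  h = inj₁ (<-≤ₒ-trans (FS⇒<ₒ f) h)

CNF-Suc : ∀ {a b} → Suc a b → CNF a → CNF b
CNF-Suc s-one      ca = cnf𝟎
CNF-Suc (s-tail s) ca = CNF-cons (CNF-exp ca) (CNF-Suc s (CNF-tail ca)) (Suc-HeadExp≤ s (CNF-head ca))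

CNF-FS : ∀ {a x b} → FS a x b → CNF a → CNF b
CNF-FS (fs-tail f)         ca = CNF-cons (CNF-exp ca) (CNF-FS f (CNF-tail ca)) (FS-HeadExp≤ f (CNF-head ca))
CNF-FS {x = x} (fs-succ s) ca = CNF-ω^· (CNF-Suc s (CNF-exp ca)) (suc x)
CNF-FS (fs-lim f)          ca = cnf1 (CNF-FS f (CNF-exp ca))

-- <ₒ is not well-founded on arbitrary terms (ω^0 + (ω^1 + 0) > ω^0 + (ω^0 + (ω^1 + 0)) > …),
-- so descent is restricted to Cantor normal forms.
_⊏_ : Ord → Ord → Set
β ⊏ α = CNF β × β <ₒ α

𝟎-acc : Acc _⊏_ 𝟎
𝟎-acc = acc λ { (_ , ()) }

-- Induction on the leading exponent, and inside it on the tail.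
module _ {a : Ord} (bounded-acc : ∀ {c} → c ⊏ a → ∀ {d} → CNF d → HeadExp≤ d c → Acc _⊏_ d) where
  ω^+-acc : ∀ {e} → HeadExp≤ e a → Acc _⊏_ e → Acc _⊏_ (ω^ a + e)
  ω^+-acc he (acc rs) = acc λ where
    (cy , z<ω)    → 𝟎-acc
    (cy , exp< p) → bounded-acc (CNF-exp cy , p) cy (inj₂ refl)
    (cy , tl< p)  → ω^+-acc (HeadExp≤-< he p) (rs (CNF-tail cy , p))

  HeadExp≤-acc : ∀ {e} → CNF e → HeadExp≤ e a → Acc _⊏_ e
  HeadExp≤-acc {𝟎}        ce h           = 𝟎-acc
  HeadExp≤-acc {ω^ c + f} ce (inj₁ c<a)  = bounded-acc (CNF-exp ce , c<a) ce (inj₂ refl)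
  HeadExp≤-acc {ω^ c + f} ce (inj₂ refl) =
    ω^+-acc (CNF-head ce) (HeadExp≤-acc (CNF-tail ce) (CNF-head ce))

acc⇒HeadExp≤-acc : ∀ {a} → Acc _⊏_ a → ∀ {d} → CNF d → HeadExp≤ d a → Acc _⊏_ d
acc⇒HeadExp≤-acc (acc rs) = HeadExp≤-acc (λ c⊏a → acc⇒HeadExp≤-acc (rs c⊏a))

CNF-acc : ∀ {α} → CNF α → Acc _⊏_ α
CNF-acc cnf𝟎              = 𝟎-acc
CNF-acc cα@(cnf1 ca)     = acc⇒HeadExp≤-acc (CNF-acc ca) cα (inj₂ refl)
CNF-acc cα@(cnf2 ca _ _) = acc⇒HeadExp≤-acc (CNF-acc ca) cα (inj₂ refl)


-- Zero, successors and limits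

data Classification : Ord → Set where
  isZero  : Classification 𝟎
  isSuc   : ∀ {α β} → Suc α β → Classification α
  isLimit : ∀ {α} → (∀ x → ∃ (FS α x)) → Classification α

classify : ∀ α → Classification α
classify 𝟎 = isZero
classify (ω^ a + 𝟎) with classify a
... | isZero    = isSuc s-one
... | isSuc s   = isLimit λ x → _ , fs-succ s
... | isLimit h = isLimit λ x → _ , fs-lim (proj₂ (h x))
classify (ω^ a + (ω^ c + d)) with classify (ω^ c + d)
... | isSuc s   = isSuc (s-tail s)
... | isLimit h = isLimit λ x → _ , fs-tail (proj₂ (h x))

FS-reindex : ∀ {α x β} → FS α x β → ∀ x' → ∃ (FS α x')
FS-reindex (fs-tail f) x' = let (_ , f') = FS-reindex f x' in _ , fs-tail f'
FS-reindex (fs-succ s) x' = _ , fs-succ s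
FS-reindex (fs-lim f)  x' = let (_ , f') = FS-reindex f x' in _ , fs-lim f'

Suc-functional : ∀ {a b b'} → Suc a b → Suc a b' → b ≡ b'
Suc-functional s-one      s-one       = refl
Suc-functional (s-tail s) (s-tail s') = cong (ω^ _ +_) (Suc-functional s s')

Suc⇒¬FS : ∀ {a b x c} → Suc a b → FS a x c → ⊥
Suc⇒¬FS s-one      (fs-tail ())
Suc⇒¬FS s-one      (fs-succ ())
Suc⇒¬FS s-one      (fs-lim ())
Suc⇒¬FS (s-tail s) (fs-tail f) = Suc⇒¬FS s f
Suc⇒¬FS (s-tail ()) (fs-succ _)
Suc⇒¬FS (s-tail ()) (fs-lim _)

FS-functional : ∀ {a x b b'} → FS a x b → FS a x b' → b ≡ b'
FS-functional (fs-tail f) (fs-tail f')           = cong (ω^ _ +_) (FS-functional f f')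
FS-functional {x = x} (fs-succ s) (fs-succ s')   = cong (λ a → ω^ a · suc x) (Suc-functional s s')
FS-functional (fs-succ s) (fs-lim f)             = ⊥-elim (Suc⇒¬FS s f)
FS-functional (fs-lim f)  (fs-succ s)            = ⊥-elim (Suc⇒¬FS s f)
FS-functional (fs-lim f)  (fs-lim f')            = cong (λ a → ω^ a + 𝟎) (FS-functional f f')

mutual
  FG-functional : ∀ {α x y y'} → FG α x y → FG α x y' → y ≡ y'
  FG-functional fg0        fg0          = refl
  FG-functional (fgs s it) (fgs s' it') with Suc-functional s s'
  ... | refl = Iter-functional it it'
  FG-functional (fgs s _)  (fgl f _)    = ⊥-elim (Suc⇒¬FS s f)
  FG-functional (fgl f _)  (fgs s _)    = ⊥-elim (Suc⇒¬FS s f)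
  FG-functional (fgl f d)  (fgl f' d')  with FS-functional f f'
  ... | refl = FG-functional d d'

  Iter-functional : ∀ {β n x y y'} → Iter (FG β) n x y → Iter (FG β) n x y' → y ≡ y'
  Iter-functional it0       it0         = refl
  Iter-functional (itS d r) (itS d' r') with FG-functional d d'
  ... | refl = Iter-functional r r'

mutual
  FG-inflationary : ∀ {α x y} → FG α x y → x < y
  FG-inflationary fg0                = ≤-refl
  FG-inflationary (fgs s (itS d r))  = ≤-trans (FG-inflationary d) (Iter-inflationary r)
  FG-inflationary (fgl f d)          = FG-inflationary d

  Iter-inflationary : ∀ {β n x y} → Iter (FG β) n x y → x ≤ y
  Iter-inflationary it0       = ≤-refl
  Iter-inflationary (itS d r) = ≤-trans (<⇒≤ (FG-inflationary d)) (Iter-inflationary r)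

Iter-F₀ : ∀ {n x y} → Iter (FG 𝟎) n x y → y ≡ n + x
Iter-F₀ it0                        = refl
Iter-F₀ {suc n} {x} (itS fg0 r)    = trans (Iter-F₀ r) (+-suc n x)

FG-≥2x+1 : ∀ {α x y} → 𝟎 <ₒ α → FG α x y → suc (x + x) ≤ y
FG-≥2x+1 _ (fgs s-one it)              = ≤-reflexive (sym (Iter-F₀ it))
FG-≥2x+1 _ (fgs (s-tail s) (itS d r))  = ≤-trans (FG-≥2x+1 z<ω d) (Iter-inflationary r)
FG-≥2x+1 _ (fgl f d)                   = FG-≥2x+1 (FS-pos f) d

Iter-total : ∀ {R : ℕ → ℕ → Set} → (∀ x → ∃ (R x)) → ∀ n x → ∃ (Iter R n x)
Iter-total total zero    x = x , it0
Iter-total total (suc n) x =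
  let (y , r) = total x
      (z , r') = Iter-total total n y
  in z , itS r r'

FG-total-acc : ∀ {α} → CNF α → Acc _⊏_ α → ∀ x → ∃ (FG α x)
FG-total-acc {α} cα (acc rs) x with classify α
... | isZero    = suc x , fg0
... | isSuc s   =
  let cβ = CNF-Suc s cα
      (y , it) = Iter-total (FG-total-acc cβ (rs (cβ , Suc⇒<ₒ s))) (suc x) x
  in y , fgs s it
... | isLimit h =
  let (μ , f) = h x
      cμ = CNF-FS f cα
      (y , d) = FG-total-acc cμ (rs (cμ , FS⇒<ₒ f)) x
  in y , fgl f d

FG-total : ∀ {α} → CNF α → ∀ x → ∃ (FG α x)
FG-total cα = FG-total-acc cα (CNF-acc cα)

-- The pointwise ordering

data _≼⟨_⟩_ : Ord → ℕ → Ord → Set where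
  ≼-refl : ∀ {x α} → α ≼⟨ x ⟩ α
  ≼-pred : ∀ {x α α' β} → Suc α α' → β ≼⟨ x ⟩ α' → β ≼⟨ x ⟩ α
  ≼-fs   : ∀ {x α α' β} → FS α x α' → β ≼⟨ x ⟩ α' → β ≼⟨ x ⟩ α

≼-trans : ∀ {x γ β α} → γ ≼⟨ x ⟩ β → β ≼⟨ x ⟩ α → γ ≼⟨ x ⟩ α
≼-trans p ≼-refl       = p
≼-trans p (≼-pred s q) = ≼-pred s (≼-trans p q)
≼-trans p (≼-fs f q)   = ≼-fs f (≼-trans p q)

≼-tail : ∀ {x a δ ε} → δ ≼⟨ x ⟩ ε → (ω^ a + δ) ≼⟨ x ⟩ (ω^ a + ε)
≼-tail ≼-refl       = ≼-refl
≼-tail (≼-pred s r) = ≼-pred (s-tail s) (≼-tail r)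
≼-tail (≼-fs f r)   = ≼-fs (fs-tail f) (≼-tail r)

𝟎≼-acc : ∀ {x α} → CNF α → Acc _⊏_ α → 𝟎 ≼⟨ x ⟩ α
𝟎≼-acc {x} {α} cα (acc rs) with classify α
... | isZero    = ≼-refl
... | isSuc s   = let cβ = CNF-Suc s cα in ≼-pred s (𝟎≼-acc cβ (rs (cβ , Suc⇒<ₒ s)))
... | isLimit h =
  let (μ , f) = h x
      cμ = CNF-FS f cα
  in ≼-fs f (𝟎≼-acc cμ (rs (cμ , FS⇒<ₒ f)))

𝟎≼ : ∀ {x α} → CNF α → 𝟎 ≼⟨ x ⟩ α
𝟎≼ cα = 𝟎≼-acc cα (CNF-acc cα)

≼-ω^ : ∀ {x δ ε} → δ ≼⟨ x ⟩ ε → CNF ε → (ω^ δ + 𝟎) ≼⟨ x ⟩ (ω^ ε + 𝟎)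
≼-ω^ ≼-refl       cε = ≼-refl
≼-ω^ (≼-fs f r)   cε = ≼-fs (fs-lim f) (≼-ω^ r (CNF-FS f cε))
≼-ω^ {x} (≼-pred s r) cε =
  ≼-fs (fs-succ s) (≼-trans (≼-ω^ r cε') (≼-tail (𝟎≼ (CNF-ω^· cε' x))))
  where cε' = CNF-Suc s cε

ω^·≼ω^·suc : ∀ {x a} → CNF a → ∀ k → (ω^ a · k) ≼⟨ x ⟩ (ω^ a · suc k)
ω^·≼ω^·suc ca zero    = 𝟎≼ (cnf1 ca)
ω^·≼ω^·suc ca (suc k) = ≼-tail (ω^·≼ω^·suc ca k)

FS-≼-next : ∀ {λ' x β β'} → FS λ' x β → FS λ' (suc x) β' → CNF λ' → β ≼⟨ suc x ⟩ β'
FS-≼-next (fs-tail f) (fs-tail f') cλ = ≼-tail (FS-≼-next f f' (CNF-tail cλ))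
FS-≼-next {x = x} (fs-succ s) (fs-succ s') cλ with Suc-functional s s'
... | refl = ω^·≼ω^·suc (CNF-Suc s (CNF-exp cλ)) (suc x)
FS-≼-next (fs-succ s) (fs-lim f)   cλ = ⊥-elim (Suc⇒¬FS s f)
FS-≼-next (fs-lim f)  (fs-succ s)  cλ = ⊥-elim (Suc⇒¬FS s f)
FS-≼-next (fs-lim f)  (fs-lim f')  cλ = ≼-ω^ (FS-≼-next f f' (CNF-exp cλ)) (CNF-FS f' (CNF-exp cλ))

≼-suc : ∀ {x β α} → β ≼⟨ x ⟩ α → CNF α → β ≼⟨ suc x ⟩ α
≼-suc ≼-refl       cα = ≼-refl
≼-suc (≼-pred s r) cα = ≼-pred s (≼-suc r (CNF-Suc s cα))
≼-suc {x} (≼-fs f r) cα =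
  let (_ , f') = FS-reindex f (suc x) in
  ≼-fs f' (≼-trans (≼-suc r (CNF-FS f cα)) (FS-≼-next f f' cα))

≼-weaken : ∀ {x x' β α} → x ≤ x' → CNF α → β ≼⟨ x ⟩ α → β ≼⟨ x' ⟩ α
≼-weaken {α = α} x≤x' cα = go (≤⇒≤′ x≤x')
  where
  go : ∀ {y y' β} → y ≤′ y' → β ≼⟨ y ⟩ α → β ≼⟨ y' ⟩ α
  go ≤′-refl      r = r
  go (≤′-step p)  r = ≼-suc (go p r) cα

≼-FG-≤ : ∀ {x β α y z} → β ≼⟨ x ⟩ α → FG β x y → FG α x z → y ≤ z
≼-FG-≤ ≼-refl d d' = ≤-reflexive (FG-functional d d')
≼-FG-≤ (≼-pred s r) d (fgs s' (itS d' r')) with Suc-functional s s'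
... | refl = ≤-trans (≼-FG-≤ r d d') (Iter-inflationary r')
≼-FG-≤ (≼-pred s r) d (fgl f _) = ⊥-elim (Suc⇒¬FS s f)
≼-FG-≤ (≼-fs f r)   d (fgl f' d') with FS-functional f f'
... | refl = ≼-FG-≤ r d d'
≼-FG-≤ (≼-fs f r)   d (fgs s _) = ⊥-elim (Suc⇒¬FS s f)

-- Monotonicity of F_α

module _ {R : ℕ → ℕ → Set}
         (functional : ∀ {x y y'} → R x y → R x y' → y ≡ y')
         (total : ∀ x → ∃ (R x))
         (step : ∀ {x y z} → R x y → R (suc x) z → y ≤ z) where

  stepwise-mono : ∀ {x x' y z} → x ≤ x' → R x y → R x' z → y ≤ z
  stepwise-mono x≤x' = go (≤⇒≤′ x≤x')
    where
    go : ∀ {x x' y z} → x ≤′ x' → R x y → R x' z → y ≤ z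
    go ≤′-refl             d d' = ≤-reflexive (functional d d')
    go (≤′-step {n} p)     d d' = let (w , e) = total n in ≤-trans (go p d e) (step e d')

Iter-mono : ∀ {R : ℕ → ℕ → Set} →
            (∀ {x x' y z} → x ≤ x' → R x y → R x' z → y ≤ z) →
            ∀ {n x x' y z} → x ≤ x' → Iter R n x y → Iter R n x' z → y ≤ z
Iter-mono mono x≤x' it0       it0         = x≤x'
Iter-mono mono x≤x' (itS d r) (itS d' r') = Iter-mono mono (mono x≤x' d d') r r'

FG-step-acc : ∀ {α} → CNF α → Acc _⊏_ α → ∀ {x y z} → FG α x y → FG α (suc x) z → y ≤ z
FG-step-acc cα _        fg0       fg0 = n≤1+n _
FG-step-acc cα _        (fgs s _) (fgl f _) = ⊥-elim (Suc⇒¬FS s f)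
FG-step-acc cα _        (fgl f _) (fgs s _) = ⊥-elim (Suc⇒¬FS s f)
FG-step-acc cα (acc rs) {x} (fgs s it) (fgs s' (itS d r)) with Suc-functional s s'
... | refl =
  let cβ = CNF-Suc s cα
      aβ = rs (cβ , Suc⇒<ₒ s)
  in Iter-mono (stepwise-mono FG-functional (FG-total-acc cβ aβ) (FG-step-acc cβ aβ))
               (≤-trans (n≤1+n x) (<⇒≤ (FG-inflationary d))) it r
-- F_λ(x) = F_{λ(x)}(x) ≤ F_{λ(x)}(x + 1) ≤ F_{λ(x+1)}(x + 1), the last step by the Bachmann property.
FG-step-acc cα (acc rs) {x} (fgl f d) (fgl f' d') =
  let cμ = CNF-FS f cα
      aμ = rs (cμ , FS⇒<ₒ f)
      (_ , e) = FG-total-acc cμ aμ (suc x)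
  in ≤-trans (FG-step-acc cμ aμ d e) (≼-FG-≤ (FS-≼-next f f' cα) e d')

FG-mono : ∀ {α} → CNF α → ∀ {x x' y z} → x ≤ x' → FG α x y → FG α x' z → y ≤ z
FG-mono cα = stepwise-mono FG-functional (FG-total cα) (FG-step-acc cα (CNF-acc cα))

-- Domination of smaller ordinals

<-Suc⇒≤ₒ : ∀ {α α' β} → Suc α α' → β <ₒ α → β ≤ₒ α'
<-Suc⇒≤ₒ s-one      z<ω      = inj₂ refl
<-Suc⇒≤ₒ (s-tail s) z<ω      = inj₁ z<ω
<-Suc⇒≤ₒ (s-tail s) (exp< p) = inj₁ (exp< p)
<-Suc⇒≤ₒ (s-tail s) (tl< q) with <-Suc⇒≤ₒ s q
... | inj₁ p    = inj₁ (tl< p)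
... | inj₂ refl = inj₂ refl

<-ω^· : ∀ {a d} → CNF d → HeadExp≤ d a → ∃[ k ] d <ₒ (ω^ a · k)
<-ω^· {d = 𝟎}         cd h           = 1 , z<ω
<-ω^· {d = ω^ c + e}  cd (inj₁ c<a)  = 1 , exp< c<a
<-ω^· {d = ω^ c + e}  cd (inj₂ refl) =
  let (k , e<) = <-ω^· (CNF-tail cd) (CNF-head cd) in suc k , tl< e<

<-limit⇒<-FS : ∀ {λ' x₀ μ₀ β} → FS λ' x₀ μ₀ → CNF β → β <ₒ λ' →
               ∃[ x ] ∃[ μ ] FS λ' x μ × β <ₒ μ
<-limit⇒<-FS {x₀ = x₀} f₀ cβ z<ω = x₀ , _ , f₀ , FS-pos f₀
<-limit⇒<-FS {x₀ = x₀} (fs-tail f₀) cβ (exp< p) = x₀ , _ , fs-tail f₀ , exp< p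
<-limit⇒<-FS (fs-tail f₀) cβ (tl< q) =
  let (x , μ , f , β<μ) = <-limit⇒<-FS f₀ (CNF-tail cβ) q in x , _ , fs-tail f , tl< β<μ
<-limit⇒<-FS (fs-succ s) cβ (exp< p) with <-Suc⇒≤ₒ s p
... | inj₁ p'   = 0 , _ , fs-succ s , exp< p'
... | inj₂ refl = let (k , q) = <-ω^· (CNF-tail cβ) (CNF-head cβ) in k , _ , fs-succ s , tl< q
<-limit⇒<-FS (fs-lim f₀) cβ (exp< p) =
  let (x , μ , f , β<μ) = <-limit⇒<-FS f₀ (CNF-exp cβ) p in x , _ , fs-lim f , exp< β<μ

<⇒≼-acc : ∀ {α} → CNF α → Acc _⊏_ α → ∀ {β} → CNF β → β <ₒ α → ∃[ N ] β ≼⟨ N ⟩ α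
<⇒≼-acc {α} cα (acc rs) cβ β<α with classify α
<⇒≼-acc cα (acc rs) cβ () | isZero
... | isSuc s with <-Suc⇒≤ₒ s β<α
...   | inj₁ β<α' =
  let cα' = CNF-Suc s cα
      (N , β≼α') = <⇒≼-acc cα' (rs (cα' , Suc⇒<ₒ s)) cβ β<α'
  in N , ≼-pred s β≼α'
...   | inj₂ refl = 0 , ≼-pred s ≼-refl
<⇒≼-acc cα (acc rs) cβ β<α | isLimit h =
  let (x , μ , f , β<μ) = <-limit⇒<-FS (proj₂ (h 0)) cβ β<α
      cμ = CNF-FS f cα
      (N , β≼μ) = <⇒≼-acc cμ (rs (cμ , FS⇒<ₒ f)) cβ β<μ
  in x + N , ≼-trans (≼-weaken (m≤n+m N x) cμ β≼μ) (≼-weaken (m≤m+n x N) cα (≼-fs f ≼-refl))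

<⇒≼ : ∀ {α β} → CNF α → CNF β → β <ₒ α → ∃[ N ] β ≼⟨ N ⟩ α
<⇒≼ cα = <⇒≼-acc cα (CNF-acc cα)

-- Bounding 𝓕_β by iterates of F_α

lookup≤maxV : ∀ {n} (v : Vec ℕ n) (i : Fin n) → lookup v i ≤ maxV v
lookup≤maxV (x ∷ v) Fin.zero    = m≤m⊔n x _
lookup≤maxV (x ∷ v) (Fin.suc i) = ≤-trans (lookup≤maxV v i) (m≤n⊔m x _)

maxV-tabulate-lub : ∀ {m B} (u : Fin m → ℕ) → (∀ i → u i ≤ B) → maxV (tabulate u) ≤ B
maxV-tabulate-lub {zero}  u u≤ = z≤n
maxV-tabulate-lub {suc m} u u≤ = ⊔-lub (u≤ Fin.zero) (maxV-tabulate-lub (λ i → u (Fin.suc i)) (λ i → u≤ (Fin.suc i)))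

maxV-singleton : ∀ x → maxV (x ∷ []) ≡ x
maxV-singleton = ⊔-identityʳ

module FastGrowing {α : Ord} (cα : CNF α) where

  open ≤-Reasoning

  F : ℕ → ℕ
  F x = proj₁ (FG-total cα x)

  F-graph : ∀ x → FG α x (F x)
  F-graph x = proj₂ (FG-total cα x)

  F-mono : ∀ {x x'} → x ≤ x' → F x ≤ F x'
  F-mono x≤x' = FG-mono cα x≤x' (F-graph _) (F-graph _)

  F^ : ℕ → ℕ → ℕ
  F^ zero    x = x
  F^ (suc n) x = F^ n (F x)

  F^-graph : ∀ n x → Iter (FG α) n x (F^ n x)
  F^-graph zero    x = it0
  F^-graph (suc n) x = itS (F-graph x) (F^-graph n (F x))

  F^-unique : ∀ {n x y} → Iter (FG α) n x y → y ≡ F^ n x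
  F^-unique it0 = refl
  F^-unique (itS d r) with FG-functional d (F-graph _)
  ... | refl = F^-unique r

  F^-+ : ∀ m n x → F^ (m + n) x ≡ F^ n (F^ m x)
  F^-+ zero    n x = refl
  F^-+ (suc m) n x = F^-+ m n (F x)

  F^-suc : ∀ n x → F^ (suc n) x ≡ F (F^ n x)
  F^-suc zero    x = refl
  F^-suc (suc n) x = F^-suc n (F x)

  F^-inflationary : ∀ n x → n + x ≤ F^ n x
  F^-inflationary zero    x = ≤-refl
  F^-inflationary (suc n) x = begin
    suc n + x     ≡⟨ sym (+-suc n x) ⟩
    n + suc x     ≤⟨ +-monoʳ-≤ n (FG-inflationary (F-graph x)) ⟩
    n + F x       ≤⟨ F^-inflationary n (F x) ⟩
    F^ n (F x)    ∎

  F^-monoʳ : ∀ n {x x'} → x ≤ x' → F^ n x ≤ F^ n x'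
  F^-monoʳ zero    x≤x' = x≤x'
  F^-monoʳ (suc n) x≤x' = F^-monoʳ n (F-mono x≤x')

  F^-monoˡ : ∀ {m n} x → m ≤ n → F^ m x ≤ F^ n x
  F^-monoˡ {m} x m≤n with m≤n⇒∃[o]m+o≡n m≤n
  ... | k , refl = begin
    F^ m x            ≤⟨ m≤n+m (F^ m x) k ⟩
    k + F^ m x        ≤⟨ F^-inflationary k (F^ m x) ⟩
    F^ k (F^ m x)     ≡⟨ sym (F^-+ m k x) ⟩
    F^ (m + k) x      ∎

  FG-below-F^ : ∀ {β} → CNF β → β <ₒ α → ∃[ d ] ∀ {x y} → FG β x y → y ≤ F^ d x
  FG-below-F^ cβ β<α =
    let (N , β≼α) = <⇒≼ cα cβ β<α in
    suc N , λ {x} {y} d →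
      let (w , e) = FG-total cβ (x + N) in begin
        y               ≤⟨ FG-mono cβ (m≤m+n x N) d e ⟩
        w               ≤⟨ ≼-FG-≤ (≼-weaken (m≤n+m N x) cα β≼α) e (F-graph (x + N)) ⟩
        F (x + N)       ≤⟨ F-mono (subst (_≤ F^ N x) (+-comm N x) (F^-inflationary N x)) ⟩
        F (F^ N x)      ≡⟨ sym (F^-suc N x) ⟩
        F^ (suc N) x    ∎

  module _ (α-pos : 𝟎 <ₒ α) {β d} (FG-β≤ : ∀ {x y} → FG β x y → y ≤ F^ d x) where

    Grz-bounded : ∀ {k f} → Grz β k f → ∃[ e ] ∀ v → f v ≤ F^ e (maxV v)
    Grz-bounded (zeroG f f≡0) = 0 , λ v → ≤-trans (≤-reflexive (f≡0 v)) z≤n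
    Grz-bounded (addG f f≡+) = 1 , λ where
      (x ∷ y ∷ []) → let m = x ⊔ (y ⊔ 0) in begin
        f (x ∷ y ∷ [])   ≡⟨ f≡+ x y ⟩
        x + y            ≤⟨ +-mono-≤ (m≤m⊔n x (y ⊔ 0)) (≤-trans (m≤m⊔n y 0) (m≤n⊔m x (y ⊔ 0))) ⟩
        m + m            <⟨ FG-≥2x+1 α-pos (F-graph m) ⟩
        F m              ∎
    Grz-bounded (projG f i f≡) = 0 , λ v → ≤-trans (≤-reflexive (f≡ v)) (lookup≤maxV v i)
    Grz-bounded (FG-G f f-graph) = d , λ where
      (x ∷ []) → subst (λ m → f (x ∷ []) ≤ F^ d m) (sym (maxV-singleton x)) (FG-β≤ (f-graph x))
    Grz-bounded (compG f h gs hG gsG f≡) =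
      let (dh , h≤) = Grz-bounded hG
          ds i = proj₁ (Grz-bounded (gsG i))
          D = maxV (tabulate ds)
          gs≤ : ∀ v i → gs i v ≤ F^ D (maxV v)
          gs≤ v i = ≤-trans (proj₂ (Grz-bounded (gsG i)) v)
                            (F^-monoˡ (maxV v) (subst (_≤ D) (lookup∘tabulate ds i) (lookup≤maxV (tabulate ds) i)))
      in D + dh , λ v → begin
        f v                                      ≡⟨ f≡ v ⟩
        h (tabulate (λ i → gs i v))              ≤⟨ h≤ _ ⟩
        F^ dh (maxV (tabulate (λ i → gs i v)))   ≤⟨ F^-monoʳ dh (maxV-tabulate-lub _ (gs≤ v)) ⟩
        F^ dh (F^ D (maxV v))                    ≡⟨ sym (F^-+ D dh (maxV v)) ⟩
        F^ (D + dh) (maxV v)                     ∎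
    Grz-bounded (lprG f g h b gG hG bG f0 fS f≤b) =
      let (db , b≤) = Grz-bounded bG in
      db , λ w → ≤-trans (f≤b w) (subst (λ m → b (maxV w ∷ []) ≤ F^ db m) (maxV-singleton (maxV w)) (b≤ _))

  GrzBelow-bounded : 𝟎 <ₒ α → ∀ {p} → GrzBelow α p → ∃[ e ] ∀ n → p n ≤ F^ e n
  GrzBelow-bounded α-pos {p} (β , cβ , β<α , p∈𝓕β) =
    let (d , FG-β≤) = FG-below-F^ cβ β<α
        (e , p≤) = Grz-bounded α-pos {d = d} FG-β≤ p∈𝓕β
    in e , λ n → subst (λ m → p n ≤ F^ e m) (maxV-singleton n) (p≤ (n ∷ []))

DTime-mono : ∀ {B : ℕ → ℕ → Set} (B' : ℕ → ℕ → Set) {Lg} →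
             (∀ n {t} → B n t → ∃[ t' ] B' n t' × t ≤ t') → DTime B Lg → DTime B' Lg
DTime-mono B' B≤B' (M , decides) = M , λ w →
  let (t , Bt , k , k≤t , halts , correct) = decides w
      (t' , B't' , t≤t') = B≤B' (length w) Bt
  in t' , B't' , k , ≤-trans k≤t t≤t' , halts , correct

id∈𝓕₀ : Grz 𝟎 1 (λ v → lookup v Fin.zero)
id∈𝓕₀ = projG _ Fin.zero (λ v → refl)

proposition5p2 : (α : Ord) → CNF α → two ≤ₒ α →
                 (Lg : Language) →
                 (FStar α Lg → Σ ℕ (λ c → 0 < c × Fbold c α Lg))
                 × (Σ ℕ (λ c → 0 < c × Fbold c α Lg) → FStar α Lg)
proposition5p2 α cα 2≤α Lg = FStar⊆Fbold , Fbold⊆FStar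
  where
  open FastGrowing cα
  open ≤-Reasoning

  α-pos : 𝟎 <ₒ α
  α-pos = <-≤ₒ-trans z<ω 2≤α

  FStar⊆Fbold : FStar α Lg → Σ ℕ (λ c → 0 < c × Fbold c α Lg)
  FStar⊆Fbold (c , Lg∈) =
    suc c , s≤s z≤n , (λ n → n) , (𝟎 , cnf𝟎 , α-pos , id∈𝓕₀) ,
    DTime-mono (Iter (FG α) (suc c)) (λ n t≡ → F^ (suc c) n , F^-graph (suc c) n , (begin
      _               ≡⟨ F^-unique t≡ ⟩
      F^ c n          ≤⟨ F^-monoˡ n (n≤1+n c) ⟩
      F^ (suc c) n    ∎)) Lg∈

  Fbold⊆FStar : Σ ℕ (λ c → 0 < c × Fbold c α Lg) → FStar α Lg
  Fbold⊆FStar (c , _ , p , p∈ , Lg∈) =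
    let (e , p≤) = GrzBelow-bounded α-pos p∈ in
    e + c ,
    DTime-mono (Iter (FG α) (e + c)) (λ n t≡ → F^ (e + c) n , F^-graph (e + c) n , (begin
      _               ≡⟨ F^-unique t≡ ⟩
      F^ c (p n)      ≤⟨ F^-monoʳ c (p≤ n) ⟩
      F^ c (F^ e n)   ≡⟨ sym (F^-+ e c n) ⟩
      F^ (e + c) n    ∎)) Lg∈
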